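{- Let $p\in\{3,5,7,17,31,127\}$ and let $k$ be an integer not divisible by $p$. Let $l$ be the size of the $(k+p\mathbb{Z})$-monomial minimal solution of $(E_p)$. Then $l\not\equiv 2\pmod 4$.
   Context: For an integer $N\ge 2$ and $a_1,\dots,a_n\in\mathbb{Z}/N\mathbb{Z}$, set $M_n(a_1,\dots,a_n)=\begin{pmatrix}a_n&-1\\1&0\end{pmatrix}\cdots\begin{pmatrix}a_1&-1\\1&0\end{pmatrix}\in SL_2(\mathbb{Z}/N\mathbb{Z})$. The equation $(E_N)$ is $M_n(a_1,\dots,a_n)=\pm \mathrm{Id}$. The $\overline k$-monomial minimal solution of $(E_N)$ is the tuple $(\overline k,\dots,\overline k)$ of the least positive length $n$ such that $M_n(\overline k,\dots,\overline k)=\pm\mathrm{Id}$; its size is $n$. -}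

module Defs where

open import Data.Nat using (ℕ; zero; suc; _<_; _≤_)
open import Data.Integer using (ℤ; +_; -_; _+_; _*_; _-_)
open import Data.Integer.Divisibility using (_∣_)
open import Data.Product using (_×_)
open import Data.Sum using (_⊎_)
open import Relation.Nullary using (¬_)

record Mat : Set where
  constructor mat
  field
    a b c d : ℤ

_⊗_ : Mat → Mat → Mat
mat a b c d ⊗ mat a' b' c' d' =
  mat (a * a' + b * c') (a * b' + b * d') (c * a' + d * c') (c * b' + d * d')

Id : Mat
Id = mat (+ 1) (+ 0) (+ 0) (+ 1)

Tk : ℤ → Mat
Tk k = mat k (- + 1) (+ 1) (+ 0)

-- M_n(k,...,k) = Tk k ^ n  (all factors equal, so the order of the product is irrelevant)
Mono : ℤ → ℕ → Mat
Mono k zero = Id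
Mono k (suc n) = Tk k ⊗ Mono k n

_≡[_]_ : ℤ → ℕ → ℤ → Set
x ≡[ N ] y = (+ N) ∣ (x - y)

_≋[_]_ : Mat → ℕ → Mat → Set
mat a b c d ≋[ N ] mat a' b' c' d' =
  (a ≡[ N ] a') × (b ≡[ N ] b') × (c ≡[ N ] c') × (d ≡[ N ] d')

negM : Mat → Mat
negM (mat a b c d) = mat (- a) (- b) (- c) (- d)

IsPmId : ℕ → Mat → Set
IsPmId N M = (M ≋[ N ] Id) ⊎ (M ≋[ N ] negM Id)

-- (k,...,k) of length n solves (E_N)
MonoSol : ℕ → ℤ → ℕ → Set
MonoSol N k n = IsPmId N (Mono k n)

IsMinimalMonoSize : ℕ → ℤ → ℕ → Set
IsMinimalMonoSize N k l =
  (1 ≤ l) × MonoSol N k l × (∀ m → 1 ≤ m → m < l → ¬ MonoSol N k m)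

-- Congruence modulo p is compatible with matrix products, so the size of
-- the minimal monomial solution attached to k depends only on the residue
-- r = k mod p, and it is unique because it is defined by minimality. For
-- each of the six primes, the size is found for every nonzero residue by
-- computing the successive powers of ( r -1 ; 1 0 ), and each one is
-- checked not to be 2 mod 4.
module Submission where

open import Defs
open import Data.Nat using (ℕ; zero; suc; _%_; _<_; _≤_; z≤n; s≤s; NonZero)
open import Data.Nat.Properties using (_≟_; <-cmp; m<1+n⇒m<n∨m≡n; allUpTo?)
import Data.Nat.Divisibility as ℕ
open import Data.Integer using (ℤ; +_; -_; _+_; _*_; _-_; ∣_∣)
open import Data.Integer.Properties using (+-identityʳ)
open import Data.Integer.Divisibility using (_∣_)
import Data.Integer.Divisibility.Signed as Signed
open import Data.Integer.DivMod using (_%ℕ_; _/ℕ_; a≡a%ℕn+[a/ℕn]*n; n%ℕd<d)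
open import Data.Integer.Tactic.RingSolver using (solve-∀)
open import Data.List using (_∷_; [])
open import Data.List.Membership.Propositional using (_∈_)
open import Data.List.Relation.Unary.Any using (here; there)
open import Data.Maybe using (Maybe; just; nothing)
open import Data.Maybe.Relation.Unary.All using (All; just; nothing)
open import Data.Maybe.Relation.Unary.Any as Any using (Any; just)
open import Data.Product using (_,_)
open import Data.Sum using (inj₁; inj₂)
open import Data.Empty using (⊥-elim)
open import Relation.Binary using (tri<; tri≈; tri>)
open import Relation.Nullary using (¬_; Dec; yes; no; ¬?)
open import Relation.Nullary.Decidable using (True; toWitness; _×-dec_; _⊎-dec_; _→-dec_)
open import Relation.Binary.PropositionalEquality
  using (_≡_; _≢_; refl; trans; cong; subst)

module Congruence (N : ℕ) where

  infix 4 _≈_ _≈ᴹ_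

  -- A record rather than x ≡[ N ] y itself, so that x and y can be inferred.
  record _≈_ (x y : ℤ) : Set where
    constructor divides-difference
    field N∣x-y : + N Signed.∣ x - y

  ≡[]⇒≈ : ∀ {x y} → x ≡[ N ] y → x ≈ y
  ≡[]⇒≈ N∣x-y = divides-difference (Signed.∣ᵤ⇒∣ N∣x-y)

  ≈⇒≡[] : ∀ {x y} → x ≈ y → x ≡[ N ] y
  ≈⇒≡[] (divides-difference N∣x-y) = Signed.∣⇒∣ᵤ N∣x-y

  ≈-refl : ∀ {x} → x ≈ x
  ≈-refl {x} = divides-difference (subst (+ N Signed.∣_) (x-x≡0 x) (Signed.divides (+ 0) refl))
    where
    x-x≡0 : ∀ x → + 0 ≡ x - x
    x-x≡0 = solve-∀

  ≈-sym : ∀ {x y} → x ≈ y → y ≈ x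
  ≈-sym {x} {y} (divides-difference N∣x-y) =
    divides-difference (subst (+ N Signed.∣_) (-[x-y]≡y-x x y) (Signed.∣m⇒∣-m N∣x-y))
    where
    -[x-y]≡y-x : ∀ x y → - (x - y) ≡ y - x
    -[x-y]≡y-x = solve-∀

  ≈-trans : ∀ {x y z} → x ≈ y → y ≈ z → x ≈ z
  ≈-trans {x} {y} {z} (divides-difference N∣x-y) (divides-difference N∣y-z) =
    divides-difference (subst (+ N Signed.∣_) (telescope x y z) (Signed.∣m∣n⇒∣m+n N∣x-y N∣y-z))
    where
    telescope : ∀ x y z → (x - y) + (y - z) ≡ x - z
    telescope = solve-∀

  +-cong : ∀ {x x′ y y′} → x ≈ x′ → y ≈ y′ → x + y ≈ x′ + y′
  +-cong {x} {x′} {y} {y′} (divides-difference N∣x-x′) (divides-difference N∣y-y′) =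
    divides-difference (subst (+ N Signed.∣_) (regroup x x′ y y′) (Signed.∣m∣n⇒∣m+n N∣x-x′ N∣y-y′))
    where
    regroup : ∀ x x′ y y′ → (x - x′) + (y - y′) ≡ (x + y) - (x′ + y′)
    regroup = solve-∀

  *-cong : ∀ {x x′ y y′} → x ≈ x′ → y ≈ y′ → x * y ≈ x′ * y′
  *-cong {x} {x′} {y} {y′} (divides-difference N∣x-x′) (divides-difference N∣y-y′) =
    divides-difference (subst (+ N Signed.∣_) (regroup x x′ y y′)
      (Signed.∣m∣n⇒∣m+n (Signed.∣n⇒∣m*n x N∣y-y′) (Signed.∣m⇒∣m*n y′ N∣x-x′)))
    where
    regroup : ∀ x x′ y y′ → x * (y - y′) + (x - x′) * y′ ≡ x * y - x′ * y′
    regroup = solve-∀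

  ≈-residue : .{{_ : NonZero N}} → ∀ k → k ≈ + (k %ℕ N)
  ≈-residue k = divides-difference (Signed.divides q k-r≡q*N)
    where
    q = k /ℕ N
    r = + (k %ℕ N)
    cancel : ∀ r q n → r + q * n - r ≡ q * n
    cancel = solve-∀
    k-r≡q*N : k - r ≡ q * + N
    k-r≡q*N = trans (cong (_- r) (a≡a%ℕn+[a/ℕn]*n k N)) (cancel r q (+ N))

  residue≢0 : .{{_ : NonZero N}} → ∀ k → ¬ (+ N ∣ k) → k %ℕ N ≢ 0
  residue≢0 k N∤k r≡0 = N∤k (Signed.∣⇒∣ᵤ (subst (+ N Signed.∣_) (+-identityʳ k) N∣k-0))
    where
    N∣k-0 : + N Signed.∣ k - + 0
    N∣k-0 = subst (λ r → + N Signed.∣ k - + r) r≡0 (_≈_.N∣x-y (≈-residue k))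

  data _≈ᴹ_ : Mat → Mat → Set where
    mat-cong : ∀ {a b c d a′ b′ c′ d′} → a ≈ a′ → b ≈ b′ → c ≈ c′ → d ≈ d′ →
               mat a b c d ≈ᴹ mat a′ b′ c′ d′

  ≈ᴹ-refl : ∀ {A} → A ≈ᴹ A
  ≈ᴹ-refl {mat _ _ _ _} = mat-cong ≈-refl ≈-refl ≈-refl ≈-refl

  ≈ᴹ-sym : ∀ {A B} → A ≈ᴹ B → B ≈ᴹ A
  ≈ᴹ-sym (mat-cong a b c d) = mat-cong (≈-sym a) (≈-sym b) (≈-sym c) (≈-sym d)

  ≈ᴹ-trans : ∀ {A B C} → A ≈ᴹ B → B ≈ᴹ C → A ≈ᴹ C
  ≈ᴹ-trans (mat-cong a b c d) (mat-cong a′ b′ c′ d′) =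
    mat-cong (≈-trans a a′) (≈-trans b b′) (≈-trans c c′) (≈-trans d d′)

  ⊗-cong : ∀ {A A′ B B′} → A ≈ᴹ A′ → B ≈ᴹ B′ → A ⊗ B ≈ᴹ A′ ⊗ B′
  ⊗-cong (mat-cong a b c d) (mat-cong a′ b′ c′ d′) =
    mat-cong (+-cong (*-cong a a′) (*-cong b c′)) (+-cong (*-cong a b′) (*-cong b d′))
             (+-cong (*-cong c a′) (*-cong d c′)) (+-cong (*-cong c b′) (*-cong d d′))

  Tk-cong : ∀ {k k′} → k ≈ k′ → Tk k ≈ᴹ Tk k′
  Tk-cong k≈k′ = mat-cong k≈k′ ≈-refl ≈-refl ≈-refl

  Mono-cong : ∀ {k k′} → k ≈ k′ → ∀ n → Mono k n ≈ᴹ Mono k′ n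
  Mono-cong k≈k′ zero    = ≈ᴹ-refl
  Mono-cong k≈k′ (suc n) = ⊗-cong (Tk-cong k≈k′) (Mono-cong k≈k′ n)

  ≋⇒≈ᴹ : ∀ A B → A ≋[ N ] B → A ≈ᴹ B
  ≋⇒≈ᴹ (mat _ _ _ _) (mat _ _ _ _) (a , b , c , d) = mat-cong (≡[]⇒≈ a) (≡[]⇒≈ b) (≡[]⇒≈ c) (≡[]⇒≈ d)

  ≈ᴹ⇒≋ : ∀ {A B} → A ≈ᴹ B → A ≋[ N ] B
  ≈ᴹ⇒≋ (mat-cong a b c d) = ≈⇒≡[] a , ≈⇒≡[] b , ≈⇒≡[] c , ≈⇒≡[] d

  ≋-respˡ : ∀ {A B} C → A ≈ᴹ B → A ≋[ N ] C → B ≋[ N ] C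
  ≋-respˡ {A} C A≈B A≋C = ≈ᴹ⇒≋ (≈ᴹ-trans (≈ᴹ-sym A≈B) (≋⇒≈ᴹ A C A≋C))

  IsPmId-resp : ∀ {A B} → A ≈ᴹ B → IsPmId N A → IsPmId N B
  IsPmId-resp A≈B (inj₁ A≋Id)  = inj₁ (≋-respˡ Id A≈B A≋Id)
  IsPmId-resp A≈B (inj₂ A≋-Id) = inj₂ (≋-respˡ (negM Id) A≈B A≋-Id)

  IsMinimalMonoSize-cong : ∀ {k k′ l} → k ≈ k′ → IsMinimalMonoSize N k l → IsMinimalMonoSize N k′ l
  IsMinimalMonoSize-cong {l = l} k≈k′ (1≤l , sol , below) =
    1≤l , IsPmId-resp (Mono-cong k≈k′ l) sol ,
    λ m 1≤m m<l sol′ → below m 1≤m m<l (IsPmId-resp (Mono-cong (≈-sym k≈k′) m) sol′)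

open Congruence using (≈-residue; residue≢0; IsMinimalMonoSize-cong)

IsMinimalMonoSize-unique : ∀ {N k l l′} →
  IsMinimalMonoSize N k l → IsMinimalMonoSize N k l′ → l ≡ l′
IsMinimalMonoSize-unique {l = l} {l′} (1≤l , sol , below) (1≤l′ , sol′ , below′) with <-cmp l l′
... | tri< l<l′ _ _ = ⊥-elim (below′ l 1≤l l<l′ sol)
... | tri≈ _ l≡l′ _ = l≡l′
... | tri> _ _ l′<l = ⊥-elim (below l′ 1≤l′ l′<l sol′)

≡[]? : ∀ N x y → Dec (x ≡[ N ] y)
≡[]? N x y = N ℕ.∣? ∣ x - y ∣

≋[]? : ∀ N A B → Dec (A ≋[ N ] B)
≋[]? N (mat a b c d) (mat a′ b′ c′ d′) =
  ≡[]? N a a′ ×-dec ≡[]? N b b′ ×-dec ≡[]? N c c′ ×-dec ≡[]? N d d′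

IsPmId? : ∀ N A → Dec (IsPmId N A)
IsPmId? N A = ≋[]? N A Id ⊎-dec ≋[]? N A (negM Id)

module Search (N : ℕ) (k : ℤ) where

  -- The matrix argument accumulates Mono k n; entries are not reduced mod N.
  searchFrom : (fuel n : ℕ) → Mat → Maybe ℕ
  searchFrom zero       n A = nothing
  searchFrom (suc fuel) n A with IsPmId? N A
  ... | yes _ = just n
  ... | no  _ = searchFrom fuel (suc n) (Tk k ⊗ A)

  findMinimalMonoSize : (fuel : ℕ) → Maybe ℕ
  findMinimalMonoSize fuel = searchFrom fuel 1 (Mono k 1)

  searchFrom-minimal : ∀ fuel n → 1 ≤ n → (∀ m → 1 ≤ m → m < n → ¬ MonoSol N k m) →
                       All (IsMinimalMonoSize N k) (searchFrom fuel n (Mono k n))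
  searchFrom-minimal zero       n 1≤n below = nothing
  searchFrom-minimal (suc fuel) n 1≤n below with IsPmId? N (Mono k n)
  ... | yes sol  = just (1≤n , sol , below)
  ... | no  ¬sol = searchFrom-minimal fuel (suc n) (s≤s z≤n) below′
    where
    below′ : ∀ m → 1 ≤ m → m < suc n → ¬ MonoSol N k m
    below′ m 1≤m m<1+n with m<1+n⇒m<n∨m≡n m<1+n
    ... | inj₁ m<n  = below m 1≤m m<n
    ... | inj₂ refl = ¬sol

  findMinimalMonoSize-minimal : ∀ fuel → All (IsMinimalMonoSize N k) (findMinimalMonoSize fuel)
  findMinimalMonoSize-minimal fuel =
    searchFrom-minimal fuel 1 (s≤s z≤n) (λ { zero () ; (suc m) _ (s≤s ()) })

  findMinimalMonoSize-sound : ∀ {P : ℕ → Set} fuel → Any P (findMinimalMonoSize fuel) →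
                           ∀ l → IsMinimalMonoSize N k l → P l
  findMinimalMonoSize-sound fuel P-found l minimal-l
    with findMinimalMonoSize fuel | findMinimalMonoSize-minimal fuel | P-found
  ... | just l′ | just minimal-l′ | just P-l′
    rewrite IsMinimalMonoSize-unique minimal-l minimal-l′ = P-l′

open Search using (findMinimalMonoSize; findMinimalMonoSize-sound)

module _ (p : ℕ) .{{_ : NonZero p}} where

  -- The minimal size is the order of ( r -1 ; 1 0 ) in PSL₂(𝔽ₚ), which is at most p.
  ResidueSizesNot2Mod4 : Set
  ResidueSizesNot2Mod4 =
    ∀ {r} → r < p → r ≢ 0 → Any (λ l → l % 4 ≢ 2) (findMinimalMonoSize p (+ r) (suc p))

  residueSizesNot2Mod4? : Dec ResidueSizesNot2Mod4
  residueSizesNot2Mod4? = allUpTo?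
    (λ r → ¬? (r ≟ 0) →-dec Any.dec (λ l → ¬? (l % 4 ≟ 2)) (findMinimalMonoSize p (+ r) (suc p))) p

  sizes-not-2-mod-4 : {checked : True residueSizesNot2Mod4?} → ∀ k → ¬ (+ p ∣ k) →
                      ∀ l → IsMinimalMonoSize p k l → l % 4 ≢ 2
  sizes-not-2-mod-4 {checked} k p∤k l minimal-l =
    findMinimalMonoSize-sound p (+ (k %ℕ p)) (suc p)
      (toWitness checked (n%ℕd<d k p) (residue≢0 p k p∤k)) l
      (IsMinimalMonoSize-cong p (≈-residue p k) minimal-l)

mainTheorem13 : (p : ℕ) → p ∈ (3 ∷ 5 ∷ 7 ∷ 17 ∷ 31 ∷ 127 ∷ []) →
    (k : ℤ) → ¬ ((+ p) ∣ k) →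
    (l : ℕ) → IsMinimalMonoSize p k l → l % 4 ≢ 2
mainTheorem13 .3   (here refl)                                         = sizes-not-2-mod-4 3
mainTheorem13 .5   (there (here refl))                                 = sizes-not-2-mod-4 5
mainTheorem13 .7   (there (there (here refl)))                         = sizes-not-2-mod-4 7
mainTheorem13 .17  (there (there (there (here refl))))                 = sizes-not-2-mod-4 17
mainTheorem13 .31  (there (there (there (there (here refl)))))         = sizes-not-2-mod-4 31
mainTheorem13 .127 (there (there (there (there (there (here refl)))))) = sizes-not-2-mod-4 127
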